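{- There are infinitely many integer triples $(a,b,c)$ with $0<a+1<b<c$, $c-a$ even, and $$(a+1)^2+(a+2)^2+\cdots+b^2=(b+1)^2+(b+2)^2+\cdots+c^2 .$$ -}

module Defs where

open import Data.Nat using (ℕ; zero; suc)
open import Data.Integer using (ℤ; _+_; _-_; _*_; ∣_∣; 0ℤ; 1ℤ)

sqSumFrom : ℤ → ℕ → ℤ
sqSumFrom m zero    = 0ℤ
sqSumFrom m (suc k) = (m + 1ℤ) * (m + 1ℤ) + sqSumFrom (m + 1ℤ) k

-- sqSum m n = (m+1)^2 + (m+2)^2 + ... + n^2, intended for m ≤ n
-- (the number of terms is n - m).
sqSum : ℤ → ℤ → ℤ
sqSum m n = sqSumFrom m ∣ n - m ∣

{-# OPTIONS --safe #-}
module Submission where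

-- Since 6 (1² + ⋯ + n²) = n (n + 1) (2n + 1), for a triple (a, a + 3k, a + 4k) six
-- times the difference of the two sums is k (3v² − 23k² − 1), where v = 2a + k + 1.
-- The Pell-type equation 3v² = 23k² + 1 has the solution (a, k) = (11, 13), and
-- multiplying v√3 + k√23 by the unit 7775 + 936√69 of ℤ[√69] maps solutions to
-- solutions with larger k; c − a = 4k is even.

open import Defs
open import Data.Nat using (ℕ)
open import Data.Integer using (ℤ; +_; _+_; _-_; _<_; _≤_; 0ℤ; 1ℤ)
open import Data.Integer.Divisibility using (_∣_)
open import Data.Product using (∃-syntax; _×_)
open import Relation.Binary.PropositionalEquality using (_≡_)

import Data.Nat as ℕ
import Data.Nat.Properties as ℕ
import Data.Nat.Divisibility as ℕ
import Data.Nat.Tactic.RingSolver as ℕ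
open import Data.Integer using (_*_; ∣_∣; +≤+; +<+)
open import Data.Integer.Properties
  using (pos-*; +-assoc; +-identityʳ; +-inverseʳ; *-zeroʳ; *-distribʳ-+; *-cancelʳ-≡)
open import Data.Integer.Tactic.RingSolver using (solve-∀)
open import Data.Product using (_,_; proj₁; proj₂)
open import Relation.Binary.PropositionalEquality using (refl; sym; trans; cong; cong₂; subst)
open Relation.Binary.PropositionalEquality.≡-Reasoning

sixPyramidal : ℤ → ℤ
sixPyramidal n = n * (n + 1ℤ) * (n + n + 1ℤ)

defect : ℤ → ℤ → ℤ
defect a k = let v = a + a + k + 1ℤ in + 3 * v * v - + 23 * k * k - 1ℤ

-- The ring solver does not unfold definitions, so the polynomial identities
-- below are proved on copies with sixPyramidal and defect inlined.

sqSumFrom-telescopes : ∀ m k → sqSumFrom m k * + 6 ≡ sixPyramidal (m + + k) - sixPyramidal m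
sqSumFrom-telescopes m ℕ.zero = sym (begin
  sixPyramidal (m + 0ℤ) - sixPyramidal m ≡⟨ cong (λ n → sixPyramidal n - sixPyramidal m) (+-identityʳ m) ⟩
  sixPyramidal m - sixPyramidal m        ≡⟨ +-inverseʳ (sixPyramidal m) ⟩
  0ℤ                                     ∎)
sqSumFrom-telescopes m (ℕ.suc k) = begin
  ((m + 1ℤ) * (m + 1ℤ) + sqSumFrom (m + 1ℤ) k) * + 6
    ≡⟨ *-distribʳ-+ (+ 6) ((m + 1ℤ) * (m + 1ℤ)) (sqSumFrom (m + 1ℤ) k) ⟩
  (m + 1ℤ) * (m + 1ℤ) * + 6 + sqSumFrom (m + 1ℤ) k * + 6
    ≡⟨ cong (_+_ ((m + 1ℤ) * (m + 1ℤ) * + 6)) (sqSumFrom-telescopes (m + 1ℤ) k) ⟩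
  (m + 1ℤ) * (m + 1ℤ) * + 6 + (sixPyramidal (m + 1ℤ + + k) - sixPyramidal (m + 1ℤ))
    ≡⟨ step m (+ k) ⟩
  sixPyramidal (m + + ℕ.suc k) - sixPyramidal m
    ∎
  where
  step : ∀ m k → let F = λ n → n * (n + 1ℤ) * (n + n + 1ℤ) in
    (m + 1ℤ) * (m + 1ℤ) * + 6 + (F (m + 1ℤ + k) - F (m + 1ℤ)) ≡ F (m + (1ℤ + k)) - F m
  step = solve-∀

m+k-m≡k : ∀ m k → m + k - m ≡ k
m+k-m≡k = solve-∀

sqSum-+ : ∀ m k → sqSum m (m + + k) ≡ sqSumFrom m k
sqSum-+ m k = cong (λ d → sqSumFrom m ∣ d ∣) (m+k-m≡k m (+ k))

sixPyramidal-gap : ∀ a k → let b = a + + 3 * k in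
  sixPyramidal b - sixPyramidal a ≡ sixPyramidal (b + k) - sixPyramidal b + k * defect a k
sixPyramidal-gap = expanded
  where
  expanded : ∀ a k → let F = λ n → n * (n + 1ℤ) * (n + n + 1ℤ)
                         D = λ a k → let v = a + a + k + 1ℤ in + 3 * v * v - + 23 * k * k - 1ℤ
                         b = a + + 3 * k
                     in F b - F a ≡ F (b + k) - F b + k * D a k
  expanded = solve-∀

sqSumFrom-balanced : ∀ a k → defect a (+ k) ≡ 0ℤ →
  sqSumFrom a (3 ℕ.* k) ≡ sqSumFrom (a + + (3 ℕ.* k)) k
sqSumFrom-balanced a k defect≡0 = *-cancelʳ-≡ _ _ (+ 6) (begin
  sqSumFrom a (3 ℕ.* k) * + 6                 ≡⟨ sqSumFrom-telescopes a (3 ℕ.* k) ⟩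
  F b - F a                                   ≡⟨ cong (λ b → F b - F a) b≡b′ ⟩
  F b′ - F a                                  ≡⟨ sixPyramidal-gap a (+ k) ⟩
  F (b′ + + k) - F b′ + + k * defect a (+ k)  ≡⟨ cong (λ d → F (b′ + + k) - F b′ + + k * d) defect≡0 ⟩
  F (b′ + + k) - F b′ + + k * 0ℤ              ≡⟨ cong (_+_ (F (b′ + + k) - F b′)) (*-zeroʳ (+ k)) ⟩
  F (b′ + + k) - F b′ + 0ℤ                    ≡⟨ +-identityʳ _ ⟩
  F (b′ + + k) - F b′                         ≡⟨ cong (λ b → F (b + + k) - F b) b≡b′ ⟨
  F (b + + k) - F b                           ≡⟨ sqSumFrom-telescopes b k ⟨
  sqSumFrom b k * + 6                         ∎)
  where
  F : ℤ → ℤ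
  F = sixPyramidal
  b b′ : ℤ
  b = a + + (3 ℕ.* k)
  b′ = a + + 3 * + k
  b≡b′ : b ≡ b′
  b≡b′ = cong (_+_ a) (pos-* 3 k)

sqSum-balanced : ∀ a k → defect a (+ k) ≡ 0ℤ →
  let b = a + + (3 ℕ.* k) in sqSum a b ≡ sqSum b (b + + k)
sqSum-balanced a k defect≡0 = begin
  sqSum a b              ≡⟨ sqSum-+ a (3 ℕ.* k) ⟩
  sqSumFrom a (3 ℕ.* k)  ≡⟨ sqSumFrom-balanced a k defect≡0 ⟩
  sqSumFrom b k          ≡⟨ sqSum-+ b k ⟨
  sqSum b (b + + k)      ∎
  where
  b : ℤ
  b = a + + (3 ℕ.* k)

2∣[a+3k+k]-a : ∀ a k → + 2 ∣ a + + (3 ℕ.* k) + + k - a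
2∣[a+3k+k]-a a k = subst (2 ℕ.∣_) (cong ∣_∣ (sym c-a≡4k)) (ℕ.divides (2 ℕ.* k) (4k≡2k*2 k))
  where
  c-a≡4k : a + + (3 ℕ.* k) + + k - a ≡ + (3 ℕ.* k ℕ.+ k)
  c-a≡4k = trans (cong (_- a) (+-assoc a (+ (3 ℕ.* k)) (+ k))) (m+k-m≡k a _)
  4k≡2k*2 : ∀ k → 3 ℕ.* k ℕ.+ k ≡ 2 ℕ.* k ℕ.* 2
  4k≡2k*2 = ℕ.solve-∀

-- With v = 2x + y + 1, pellStep is (v√3 + y√23) ↦ (v√3 + y√23)(7775 + 936√69).
pellStep : ℕ × ℕ → ℕ × ℕ
pellStep (x , y) = 4967 ℕ.* x ℕ.+ 9360 ℕ.* y ℕ.+ 2483 , 5616 ℕ.* x ℕ.+ 10583 ℕ.* y ℕ.+ 2808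

pellOrbit : ℕ → ℕ × ℕ
pellOrbit ℕ.zero    = 11 , 13
pellOrbit (ℕ.suc n) = pellStep (pellOrbit n)

pos-affine : ∀ α β γ x y → + (α ℕ.* x ℕ.+ β ℕ.* y ℕ.+ γ) ≡ + α * + x + + β * + y + + γ
pos-affine α β γ x y = cong₂ (λ u v → u + v + + γ) (pos-* α x) (pos-* β y)

defect-pellStep : ∀ x y → let (x′ , y′) = pellStep (x , y) in defect (+ x′) (+ y′) ≡ defect (+ x) (+ y)
defect-pellStep x y = trans
  (cong₂ defect (pos-affine 4967 9360 2483 x y) (pos-affine 5616 10583 2808 x y))
  (expanded (+ x) (+ y))
  where
  expanded : ∀ x y → let D = λ a k → let v = a + a + k + 1ℤ in + 3 * v * v - + 23 * k * k - 1ℤ in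
    D (+ 4967 * x + + 9360 * y + + 2483) (+ 5616 * x + + 10583 * y + + 2808) ≡ D x y
  expanded = solve-∀

pellOrbit-defect : ∀ n → let (x , y) = pellOrbit n in defect (+ x) (+ y) ≡ 0ℤ
pellOrbit-defect ℕ.zero    = refl
pellOrbit-defect (ℕ.suc n) = let (x , y) = pellOrbit n in trans (defect-pellStep x y) (pellOrbit-defect n)

y<pellStep-y : ∀ x y → y ℕ.< proj₂ (pellStep (x , y))
y<pellStep-y x y =
  ℕ.≤-<-trans (ℕ.≤-trans (ℕ.m≤n*m y 10583) (ℕ.m≤n+m _ (5616 ℕ.* x))) (ℕ.m<m+n _ ℕ.z<s)

n<pellOrbit-y : ∀ n → n ℕ.< proj₂ (pellOrbit n)
n<pellOrbit-y ℕ.zero    = ℕ.z<s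
n<pellOrbit-y (ℕ.suc n) = let (x , y) = pellOrbit n in ℕ.≤-<-trans (n<pellOrbit-y n) (y<pellStep-y x y)

theorem1p4 : (N : ℕ) → ∃[ a ] ∃[ b ] ∃[ c ]
    ((+ N ≤ c) × (0ℤ < a + 1ℤ) × (a + 1ℤ < b) × (b < c) × ((+ 2) ∣ (c - a))
      × (sqSum a b ≡ sqSum b c))
theorem1p4 N = a , b , c , +≤+ N≤c , +<+ (ℕ.m≤n+m 1 x) , +<+ a+1<b , +<+ (ℕ.m<m+n _ 0<y) ,
  2∣[a+3k+k]-a a y , sqSum-balanced a y (pellOrbit-defect N)
  where
  x y : ℕ
  x = proj₁ (pellOrbit N)
  y = proj₂ (pellOrbit N)
  a b c : ℤ
  a = + x
  b = a + + (3 ℕ.* y)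
  c = b + + y
  0<y : 0 ℕ.< y
  0<y = ℕ.≤-<-trans ℕ.z≤n (n<pellOrbit-y N)
  N≤c : N ℕ.≤ x ℕ.+ 3 ℕ.* y ℕ.+ y
  N≤c = ℕ.≤-trans (ℕ.<⇒≤ (n<pellOrbit-y N)) (ℕ.m≤n+m y _)
  a+1<b : x ℕ.+ 1 ℕ.< x ℕ.+ 3 ℕ.* y
  a+1<b = ℕ.+-monoʳ-< x (ℕ.<-≤-trans (ℕ.s<s ℕ.z<s) (ℕ.*-monoʳ-≤ 3 0<y))
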